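{- $1\oplus=\mathrm{co}\text{ - }1\oplus$ and $1\mathrm{SP}=\mathrm{co}\text{ - }1\mathrm{SP}$.
   Context: A one-way nondeterministic finite automaton (1nfa) is $M=(Q,\Sigma,\{\rhd,\lhd\},\delta,q_0,Q_{acc},Q_{rej})$: finite state set $Q$, input alphabet $\Sigma$, endmarkers $\rhd,\lhd\notin\Sigma$, disjoint sets $Q_{acc},Q_{rej}\subseteq Q$ ($Q_{halt}=Q_{acc}\cup Q_{rej}$), transition function $\delta:(Q-Q_{halt})\times(\Sigma\cup\{\rhd,\lhd\})\to\mathcal P(Q)$. On input $x$ it reads $\rhd x\lhd$ left to right, moving its head one cell right at every step (no $\lambda$-moves), halting on entering a halting state. A path is accepting (resp. rejecting) if it enters $Q_{acc}$ (resp. $Q_{rej}$), otherwise neither. $\#M(x)$, $\#\overline{M}(x)$ are the numbers of accepting and rejecting paths on $x$. A family $\{M_n\}_{n\in\mathbb N}$ has polynomial size if $|Q_n|\le p(n)$ for a fixed polynomial $p$. A family of promise problems over a fixed alphabet $\Sigma$ is $\mathcal L=\{(L_n^{(+)},L_n^{(-)})\}_{n\in\mathbb N}$ with $L_n^{(+)},L_n^{(-)}\subseteq\Sigma^*$ disjoint; $\mathrm{co}\text{ - }\mathcal L=\{(L_n^{(-)},L_n^{(+)})\}_n$ and $\mathrm{co}\text{ - }\mathcal C=\{\mathrm{co}\text{ - }\mathcal L:\mathcal L\in\mathcal C\}$. A family of partial functions is $\{(f_n,D_n)\}_n$, $D_n\subseteq\Sigma^*$. $1\#$ (resp. $1\mathrm{Gap}$)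 is the class of such families for which a polynomial-size family of 1nfa's satisfies $f_n(x)=\#M_n(x)$ (resp. $f_n(x)=\#M_n(x)-\#\overline{M}_n(x)$) for all $n$, $x\in D_n$. $\mathcal L\in1\oplus$ iff some $\{(f_n,D_n)\}\in1\#$ has $L_n^{(+)}\cup L_n^{(-)}\subseteq D_n$, $f_n$ odd on $L_n^{(+)}$ and even on $L_n^{(-)}$ for all $n$; $\mathcal L\in1\mathrm{SP}$ iff some $\{(f_n,D_n)\}\in1\mathrm{Gap}$ has $L_n^{(+)}\cup L_n^{(-)}\subseteq D_n$, $f_n=1$ on $L_n^{(+)}$ and $f_n=0$ on $L_n^{(-)}$ for all $n$. -}

module Defs where

open import Data.Nat using (ℕ; zero; suc; _+_; _*_; _^_; _≤_; _%_)
open import Data.Integer using (ℤ; +_; _-_)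
open import Data.Fin using (Fin)
open import Data.Bool using (Bool; true; false; if_then_else_; _∨_)
open import Data.List using (List; []; _∷_; map; allFin; _++_)
open import Data.Nat.ListAction using (sum)
open import Data.Product using (Σ; ∃; _×_; _,_)
open import Data.Sum using (_⊎_)
open import Data.Empty using (⊥)
open import Relation.Binary.PropositionalEquality using (_≡_)
open import Function.Bundles using (_⇔_)

data Sym (k : ℕ) : Set where
  ▷ : Sym k
  ◁ : Sym k
  sym : Fin k → Sym k

-- A one-way nondeterministic finite automaton (no λ-moves).
-- The state set is Fin states; subsets of states are characteristic functions.
-- δ q σ q' = true  iff  q' ∈ δ(q,σ).  (δ on halting states is never consulted.)
record NFA (k : ℕ) : Set where
  field
    states   : ℕ
    δ        : Fin states → Sym k → Fin states → Bool
    q₀       : Fin states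
    isAcc    : Fin states → Bool
    isRej    : Fin states → Bool
    disjoint : ∀ q → isAcc q ≡ true → isRej q ≡ false

  isHalt : Fin states → Bool
  isHalt q = isAcc q ∨ isRej q

  -- Number of computation paths, starting in state q with remaining tape w
  -- (head on the first symbol of w), that enter a halting state q with
  -- target q = true.  A path halts as soon as it enters a halting state;
  -- a path in a non-halting state after the right endmarker (or with an
  -- empty set of successors) is neither accepting nor rejecting.
  paths : (Fin states → Bool) → Fin states → List (Sym k) → ℕ
  paths t q [] = if isHalt q then (if t q then 1 else 0) else 0
  paths t q (σ ∷ w) =
    if isHalt q then (if t q then 1 else 0)
    else sum (map (λ q' → if δ q σ q' then paths t q' w else 0) (allFin states))

  tape : List (Fin k) → List (Sym k)
  tape x = ▷ ∷ map sym x ++ (◁ ∷ [])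

  #acc : List (Fin k) → ℕ
  #acc x = paths isAcc q₀ (tape x)

  #rej : List (Fin k) → ℕ
  #rej x = paths isRej q₀ (tape x)

open NFA public

-- Polynomial size: |Q_n| ≤ p(n) for a fixed polynomial p
-- (equivalently, bounded by c·n^c + c for some constant c).
PolySize : ∀ {k} → (ℕ → NFA k) → Set
PolySize M = ∃ λ c → ∀ n → states (M n) ≤ c * n ^ c + c

record Promise (k : ℕ) : Set₁ where
  field
    Lpos : ℕ → List (Fin k) → Set
    Lneg : ℕ → List (Fin k) → Set
    disj : ∀ n x → Lpos n x → Lneg n x → ⊥

open Promise public

co : ∀ {k} → Promise k → Promise k
co L = record { Lpos = Lneg L ; Lneg = Lpos L ; disj = λ n x p q → disj L n x q p }

-- co-C = { co-L : L ∈ C };  since co is an involution, L ∈ co-C iff co-L ∈ C.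
coClass : ∀ {k} → (Promise k → Set₁) → (Promise k → Set₁)
coClass C L = C (co L)

-- Families of partial functions {(f_n, D_n)}.
In1# : ∀ {k} → (ℕ → List (Fin k) → ℕ) → (ℕ → List (Fin k) → Set) → Set
In1# {k} f D = Σ (ℕ → NFA k) λ M → PolySize M × (∀ n x → D n x → f n x ≡ #acc (M n) x)

In1Gap : ∀ {k} → (ℕ → List (Fin k) → ℤ) → (ℕ → List (Fin k) → Set) → Set
In1Gap {k} f D = Σ (ℕ → NFA k) λ M → PolySize M ×
  (∀ n x → D n x → f n x ≡ (+ #acc (M n) x) - (+ #rej (M n) x))

In1⊕ : ∀ {k} → Promise k → Set₁
In1⊕ {k} L = Σ (ℕ → List (Fin k) → ℕ) λ f → Σ (ℕ → List (Fin k) → Set) λ D →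
  In1# f D ×
  (∀ n x → Lpos L n x ⊎ Lneg L n x → D n x) ×
  (∀ n x → Lpos L n x → f n x % 2 ≡ 1) ×
  (∀ n x → Lneg L n x → f n x % 2 ≡ 0)

In1SP : ∀ {k} → Promise k → Set₁
In1SP {k} L = Σ (ℕ → List (Fin k) → ℤ) λ f → Σ (ℕ → List (Fin k) → Set) λ D →
  In1Gap f D ×
  (∀ n x → Lpos L n x ⊎ Lneg L n x → D n x) ×
  (∀ n x → Lpos L n x → f n x ≡ + 1) ×
  (∀ n x → Lneg L n x → f n x ≡ + 0)

_≡Class_ : ∀ {k} → (Promise k → Set₁) → (Promise k → Set₁) → Set₁
C ≡Class C' = ∀ L → C L ⇔ C' L

-- Both classes are closed under complementation by adding one accepting path: a fresh
-- initial state that, on the left endmarker, both accepts and starts simulating M gives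
-- #M′ = #M + 1, which flips parity.  Doing the same after exchanging the accepting and
-- rejecting states gives the gap 1 + #M̄ − #M = 1 − (#M − #M̄), which swaps 1 and 0.
-- Only two states are added, so polynomial size is preserved.

module Submission where

open import Defs hiding (sym)
import Algebra.Properties.Monoid.Sum as ∑
open import Data.Bool using (Bool; true; false; if_then_else_)
open import Data.Bool.Properties using (∨-comm)
open import Data.Fin using (Fin; zero; suc; _≟_)
open import Data.Integer as ℤ using (_-_)
open import Data.Integer.Tactic.RingSolver using (solve-∀)
open import Data.List using (List; []; _∷_; _++_; map; allFin; tabulate)
open import Data.List.Properties using (map-tabulate; map-cong)
open import Data.Nat using (ℕ; zero; suc; _+_; _*_; _^_; _≤_; _%_; z≤n)
open import Data.Nat.DivMod using (%-distribˡ-+)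
open import Data.Nat.ListAction using (sum)
open import Data.Nat.Properties
  using ( +-0-monoid; +-identityʳ; +-assoc; +-comm; *-zeroʳ; m≤m+n
        ; +-monoʳ-≤; +-monoˡ-≤; *-mono-≤; ^-monoʳ-≤; module ≤-Reasoning)
open import Data.Product using (∃; _×_; _,_)
open import Data.Sum using () renaming (swap to ⊎-swap)
open import Function using (_∘_)
open import Function.Bundles using (mk⇔)
open import Relation.Nullary.Decidable using (does)
open import Relation.Binary.PropositionalEquality
  using (_≡_; refl; sym; trans; cong; cong₂; module ≡-Reasoning)

open ∑ +-0-monoid using (sum-syntax; sum-cong-≗; sum-replicate-zero)

sum-allFin : ∀ n (g : Fin n → ℕ) → sum (map g (allFin n)) ≡ ∑[ i < n ] g i
sum-allFin zero    g = refl
sum-allFin (suc n) g = cong (g zero +_) (begin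
  sum (map g (tabulate suc))         ≡⟨ cong sum (map-tabulate suc g) ⟩
  sum (tabulate (g ∘ suc))           ≡⟨ cong sum (map-tabulate (λ i → i) (g ∘ suc)) ⟨
  sum (map (g ∘ suc) (allFin n))     ≡⟨ sum-allFin n (g ∘ suc) ⟩
  ∑[ i < n ] g (suc i)               ∎)
  where open ≡-Reasoning

∑-indicator : ∀ {n} (j : Fin n) (h : Fin n → ℕ) →
              ∑[ i < n ] (if does (i ≟ j) then h i else 0) ≡ h j
∑-indicator {suc n} zero    h = trans (cong (h zero +_) (sum-replicate-zero n)) (+-identityʳ (h zero))
∑-indicator {suc n} (suc j) h = ∑-indicator j (h ∘ suc)

module _ {k} (M : NFA k) where

  paths-∑ : ∀ t q σ w → paths M t q (σ ∷ w) ≡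
            (if isHalt M q then (if t q then 1 else 0)
             else ∑[ q' < states M ] (if δ M q σ q' then paths M t q' w else 0))
  paths-∑ t q σ w = cong (if isHalt M q then _ else_) (sum-allFin (states M) _)

  paths-halting : ∀ t q w → isHalt M q ≡ true → paths M t q w ≡ (if t q then 1 else 0)
  paths-halting t q []      h rewrite h = refl
  paths-halting t q (σ ∷ w) h rewrite h = refl

  -- A halting state behaves as if it stayed put: this lets every state be unfolded by one step.
  successor : Fin (states M) → Sym k → Fin (states M) → Bool
  successor q σ q' = if isHalt M q then does (q' ≟ q) else δ M q σ q'

  paths-step : ∀ t q σ w → paths M t q (σ ∷ w) ≡
               ∑[ q' < states M ] (if successor q σ q' then paths M t q' w else 0)
  paths-step t q σ w with isHalt M q in h
  ... | true  = sym (trans (∑-indicator q (λ q' → paths M t q' w)) (paths-halting t q w h))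
  ... | false = sum-allFin (states M) _

  rejecting⇒¬accepting : ∀ q → isRej M q ≡ true → isAcc M q ≡ false
  rejecting⇒¬accepting q r with isAcc M q in a
  ... | false = refl
  ... | true  with trans (sym r) (disjoint M q a)
  ... | ()

  swapVerdicts : NFA k
  swapVerdicts = record
    { states = states M ; δ = δ M ; q₀ = q₀ M
    ; isAcc = isRej M ; isRej = isAcc M ; disjoint = rejecting⇒¬accepting }

  isHalt-swapVerdicts : ∀ q → isHalt swapVerdicts q ≡ isHalt M q
  isHalt-swapVerdicts q = ∨-comm (isRej M q) (isAcc M q)

  paths-swapVerdicts : ∀ t q w → paths swapVerdicts t q w ≡ paths M t q w
  paths-swapVerdicts t q [] =
    cong (λ h → if h then (if t q then 1 else 0) else 0) (isHalt-swapVerdicts q)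
  paths-swapVerdicts t q (σ ∷ w) =
    cong₂ (λ h s → if h then (if t q then 1 else 0) else s) (isHalt-swapVerdicts q)
      (cong sum (map-cong (λ q' → cong (if δ M q σ q' then_else 0) (paths-swapVerdicts t q' w))
                          (allFin (states M))))

  #acc-swapVerdicts : ∀ x → #acc swapVerdicts x ≡ #rej M x
  #acc-swapVerdicts x = paths-swapVerdicts (isRej M) (q₀ M) (tape M x)

  #rej-swapVerdicts : ∀ x → #rej swapVerdicts x ≡ #acc M x
  #rej-swapVerdicts x = paths-swapVerdicts (isAcc M) (q₀ M) (tape M x)

module _ {k} (M : NFA k) where

  -- State 0 is a fresh initial state, state 1 a fresh accepting state, and suc (suc q) is q.
  -- On its first symbol the fresh initial state both accepts (via 1) and takes the first step of M.
  addAcceptingPath : NFA k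
  addAcceptingPath = record
    { states = suc (suc (states M)) ; δ = δ⁺ ; q₀ = zero
    ; isAcc = acc⁺ ; isRej = rej⁺ ; disjoint = disjoint⁺ }
    where
    δ⁺ : Fin (suc (suc (states M))) → Sym k → Fin (suc (suc (states M))) → Bool
    δ⁺ zero           σ (suc zero)     = true
    δ⁺ zero           σ (suc (suc q')) = successor M (q₀ M) σ q'
    δ⁺ (suc (suc q))  σ (suc (suc q')) = δ M q σ q'
    δ⁺ _              _ _              = false

    acc⁺ rej⁺ : Fin (suc (suc (states M))) → Bool
    acc⁺ zero          = false
    acc⁺ (suc zero)    = true
    acc⁺ (suc (suc q)) = isAcc M q
    rej⁺ zero          = false
    rej⁺ (suc zero)    = false
    rej⁺ (suc (suc q)) = isRej M q

    disjoint⁺ : ∀ q → acc⁺ q ≡ true → rej⁺ q ≡ false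
    disjoint⁺ (suc zero)    _ = refl
    disjoint⁺ (suc (suc q))   = disjoint M q

  embed : Fin (states M) → Fin (states addAcceptingPath)
  embed q = suc (suc q)

  paths-addAcceptingPath-embed : ∀ t q w →
    paths addAcceptingPath t (embed q) w ≡ paths M (t ∘ embed) q w
  paths-addAcceptingPath-embed t q [] = refl
  paths-addAcceptingPath-embed t q (σ ∷ w) = begin
    paths addAcceptingPath t (embed q) (σ ∷ w)
      ≡⟨ paths-∑ addAcceptingPath t (embed q) σ w ⟩
    (if isHalt M q then (if t (embed q) then 1 else 0)
     else ∑[ q' < states M ] (if δ M q σ q' then paths addAcceptingPath t (embed q') w else 0))
      ≡⟨ cong (if isHalt M q then _ else_) (sum-cong-≗ λ q' →
           cong (if δ M q σ q' then_else 0) (paths-addAcceptingPath-embed t q' w)) ⟩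
    (if isHalt M q then (if t (embed q) then 1 else 0)
     else ∑[ q' < states M ] (if δ M q σ q' then paths M (t ∘ embed) q' w else 0))
      ≡⟨ paths-∑ M (t ∘ embed) q σ w ⟨
    paths M (t ∘ embed) q (σ ∷ w)
      ∎
    where open ≡-Reasoning

  paths-addAcceptingPath-start : ∀ t σ w → paths addAcceptingPath t zero (σ ∷ w) ≡
    (if t (suc zero) then 1 else 0) + paths M (t ∘ embed) (q₀ M) (σ ∷ w)
  paths-addAcceptingPath-start t σ w = begin
    paths addAcceptingPath t zero (σ ∷ w)
      ≡⟨ paths-∑ addAcceptingPath t zero σ w ⟩
    paths addAcceptingPath t (suc zero) w
      + ∑[ q' < states M ] (if successor M (q₀ M) σ q' then paths addAcceptingPath t (embed q') w else 0)
      ≡⟨ cong₂ _+_ (paths-halting addAcceptingPath t (suc zero) w refl) (sum-cong-≗ λ q' →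
           cong (if successor M (q₀ M) σ q' then_else 0) (paths-addAcceptingPath-embed t q' w)) ⟩
    (if t (suc zero) then 1 else 0)
      + ∑[ q' < states M ] (if successor M (q₀ M) σ q' then paths M (t ∘ embed) q' w else 0)
      ≡⟨ cong ((if t (suc zero) then 1 else 0) +_) (paths-step M (t ∘ embed) (q₀ M) σ w) ⟨
    (if t (suc zero) then 1 else 0) + paths M (t ∘ embed) (q₀ M) (σ ∷ w)
      ∎
    where open ≡-Reasoning

  #acc-addAcceptingPath : ∀ x → #acc addAcceptingPath x ≡ suc (#acc M x)
  #acc-addAcceptingPath x =
    paths-addAcceptingPath-start (isAcc addAcceptingPath) ▷ (map Sym.sym x ++ ◁ ∷ [])

  #rej-addAcceptingPath : ∀ x → #rej addAcceptingPath x ≡ #rej M x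
  #rej-addAcceptingPath x =
    paths-addAcceptingPath-start (isRej addAcceptingPath) ▷ (map Sym.sym x ++ ◁ ∷ [])

c*n^c≤[c+d]*n^[c+d] : ∀ c d n → c * n ^ c ≤ (c + d) * n ^ (c + d)
c*n^c≤[c+d]*n^[c+d] zero    d n       = z≤n
c*n^c≤[c+d]*n^[c+d] (suc c) d zero    rewrite *-zeroʳ c = z≤n
c*n^c≤[c+d]*n^[c+d] (suc c) d (suc n) =
  *-mono-≤ (m≤m+n (suc c) d) (^-monoʳ-≤ (suc n) (m≤m+n (suc c) d))

polyBound-+ : ∀ d (s : ℕ → ℕ) → (∃ λ c → ∀ n → s n ≤ c * n ^ c + c) →
              ∃ λ c → ∀ n → d + s n ≤ c * n ^ c + c
polyBound-+ d s (c , s≤) = c + d , λ n → begin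
  d + s n                          ≤⟨ +-monoʳ-≤ d (s≤ n) ⟩
  d + (c * n ^ c + c)              ≡⟨ +-comm d _ ⟩
  c * n ^ c + c + d                ≡⟨ +-assoc (c * n ^ c) c d ⟩
  c * n ^ c + (c + d)              ≤⟨ +-monoˡ-≤ (c + d) (c*n^c≤[c+d]*n^[c+d] c d n) ⟩
  (c + d) * n ^ (c + d) + (c + d)  ∎
  where open ≤-Reasoning

PolySize-addAcceptingPath : ∀ {k} {M : ℕ → NFA k} → PolySize M → PolySize (addAcceptingPath ∘ M)
PolySize-addAcceptingPath {M = M} = polyBound-+ 2 (states ∘ M)

module _ {k} {D : ℕ → List (Fin k) → Set} where

  In1#-suc : ∀ {f} → In1# f D → In1# (λ n x → suc (f n x)) D
  In1#-suc {f} (M , poly , f≡#acc) =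
    addAcceptingPath ∘ M , PolySize-addAcceptingPath {M = M} poly , λ n x d → begin
    suc (f n x)                          ≡⟨ cong suc (f≡#acc n x d) ⟩
    suc (#acc (M n) x)                   ≡⟨ #acc-addAcceptingPath (M n) x ⟨
    #acc (addAcceptingPath (M n)) x      ∎
    where open ≡-Reasoning

  In1Gap-1- : ∀ {f} → In1Gap f D → In1Gap (λ n x → ℤ.+ 1 - f n x) D
  In1Gap-1- {f} (M , poly , f≡gap) =
    M′ , PolySize-addAcceptingPath {M = swapVerdicts ∘ M} poly , λ n x d → begin
    ℤ.+ 1 - f n x
      ≡⟨ cong (ℤ.+ 1 -_) (f≡gap n x d) ⟩
    ℤ.+ 1 - (ℤ.+ #acc (M n) x - ℤ.+ #rej (M n) x)
      ≡⟨ 1-[a-r]≡[1+r]-a (ℤ.+ #acc (M n) x) (ℤ.+ #rej (M n) x) ⟩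
    ℤ.+ suc (#rej (M n) x) - ℤ.+ #acc (M n) x
      ≡⟨ cong₂ (λ a r → ℤ.+ a - ℤ.+ r) (#acc-M′ n x) (#rej-M′ n x) ⟨
    ℤ.+ #acc (M′ n) x - ℤ.+ #rej (M′ n) x
      ∎
    where
    open ≡-Reasoning
    M′ : ℕ → NFA k
    M′ n = addAcceptingPath (swapVerdicts (M n))

    #acc-M′ : ∀ n x → #acc (M′ n) x ≡ suc (#rej (M n) x)
    #acc-M′ n x = trans (#acc-addAcceptingPath (swapVerdicts (M n)) x)
                        (cong suc (#acc-swapVerdicts (M n) x))

    #rej-M′ : ∀ n x → #rej (M′ n) x ≡ #acc (M n) x
    #rej-M′ n x = trans (#rej-addAcceptingPath (swapVerdicts (M n)) x) (#rej-swapVerdicts (M n) x)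

    1-[a-r]≡[1+r]-a : ∀ a r → ℤ.+ 1 - (a - r) ≡ (ℤ.+ 1 ℤ.+ r) - a
    1-[a-r]≡[1+r]-a = solve-∀

suc-%2 : ∀ m → suc m % 2 ≡ (1 + m % 2) % 2
suc-%2 m = %-distribˡ-+ 1 m 2

module _ {k} (L : Promise k) where

  In1⊕-co : In1⊕ L → In1⊕ (co L)
  In1⊕-co (f , D , f∈1# , dom , odd , even) =
    (λ n x → suc (f n x)) , D , In1#-suc f∈1# , (λ n x → dom n x ∘ ⊎-swap) ,
    (λ n x p → trans (suc-%2 (f n x)) (cong (λ r → (1 + r) % 2) (even n x p))) ,
    (λ n x p → trans (suc-%2 (f n x)) (cong (λ r → (1 + r) % 2) (odd n x p)))

  In1SP-co : In1SP L → In1SP (co L)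
  In1SP-co (f , D , f∈1Gap , dom , f≡1 , f≡0) =
    (λ n x → ℤ.+ 1 - f n x) , D , In1Gap-1- f∈1Gap , (λ n x → dom n x ∘ ⊎-swap) ,
    (λ n x p → cong (ℤ.+ 1 -_) (f≡0 n x p)) ,
    (λ n x p → cong (ℤ.+ 1 -_) (f≡1 n x p))

-- co (co L) is L up to record η, so closure under co in one direction suffices.
≡Class-coClass : ∀ {k} {C : Promise k → Set₁} → (∀ L → C L → C (co L)) → C ≡Class coClass C
≡Class-coClass C-co L = mk⇔ (C-co L) (C-co (co L))

lemma4p1 : (k : ℕ) → (In1⊕ {k} ≡Class coClass In1⊕) × (In1SP {k} ≡Class coClass In1SP)
lemma4p1 k = ≡Class-coClass In1⊕-co , ≡Class-coClass In1SP-co
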